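{- Let $n$ be an integer with $n \geq 20$ or with $n \in \{5,8,10,11,13,14,16,17\}$, and write $n = 3k + r$ with $r \in \{0,1,2\}$. Then there is an $n$-vertex $d$-regular $K_3$-saturated graph, where $d = k + (r-1)$.
   Context: All graphs are finite and simple. A graph $G$ is $K_3$-saturated if $G$ contains no triangle, but adding any edge between two nonadjacent vertices of $G$ creates a triangle. A graph is $d$-regular if every vertex has degree $d$. -}

module Defs where

open import Data.Nat using (ℕ; _+_; _*_; _∸_; _<_; _≥_)
open import Data.Fin using (Fin)
open import Data.Bool using (Bool; true; false)
open import Data.List using (List; filter; length; allFin)
open import Data.Product using (Σ; ∃; _×_; _,_)
open import Data.Sum using (_⊎_)
open import Relation.Binary.PropositionalEquality using (_≡_; _≢_)
open import Relation.Nullary using (¬_)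
open import Data.Empty using (⊥)
open import Data.Bool.Properties using (T?)
open import Data.Bool using (T)

record Graph (n : ℕ) : Set where
  field
    adj       : Fin n → Fin n → Bool
    symmetric : ∀ u v → adj u v ≡ adj v u
    loopless  : ∀ v → adj v v ≡ false
open Graph public

Adj : ∀ {n} → Graph n → Fin n → Fin n → Set
Adj G u v = adj G u v ≡ true

degree : ∀ {n} → Graph n → Fin n → ℕ
degree {n} G v = length (filter (λ u → T? (adj G v u)) (allFin n))

Regular : ∀ {n} → Graph n → ℕ → Set
Regular G d = ∀ v → degree G v ≡ d

TriangleFree : ∀ {n} → Graph n → Set
TriangleFree G = ∀ u v w → Adj G u v → Adj G v w → Adj G u w → ⊥

K3Saturated : ∀ {n} → Graph n → Set
K3Saturated {n} G =
  TriangleFree G ×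
  (∀ u v → u ≢ v → ¬ Adj G u v → ∃ λ (w : Fin n) → Adj G u w × Adj G w v)

-- Apart from the Petersen graph for n = 10, every graph constructed here is a circulant graph
-- on ℤ/n whose connection set S is symmetric, sum-free, and such that every nonzero element
-- outside S is a sum of two elements of S. Sum-freeness makes the graph triangle-free, the
-- second property puts every non-edge into a triangle once it is added, and the graph is
-- |S|-regular. For each residue of n modulo 3 the set S is a union of residue classes modulo 3
-- cut down to intervals whose endpoints depend affinely on k; the three properties and |S| then
-- reduce to finitely many comparisons of affine forms, which are decided by evaluation.

module Submission where

open import Defs
open import Data.Bool using (Bool; true; false; T; not; _∧_; _∨_; _xor_; if_then_else_)
open import Data.Bool.ListAction using (all; any)
open import Data.Bool.Properties using (T?; T-≡; T-∧; ¬-not)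
open import Data.Empty using (⊥; ⊥-elim)
import Data.Fin as Fin
open Fin using (Fin; toℕ; fromℕ<; #_)
open import Data.Fin.Properties using (toℕ-injective; toℕ<n; toℕ-fromℕ<) renaming (_≟_ to _≟ᶠ_)
open import Data.List using (List; []; _∷_; length; filter; filterᵇ; tabulate; concatMap; allFin; lookup)
open import Data.List.Membership.Propositional using (_∈_; lose; find)
open import Data.List.Membership.Propositional.Properties
  using (∈-concatMap⁻; ∈-concatMap⁺; ∈-allFin; ∈-filter⁺; ∈-filter⁻)
import Data.List.Relation.Unary.All as All
open import Data.List.Relation.Unary.All.Properties using (all⁺)
open import Data.List.Relation.Unary.Any using (here; there; satisfied)
open import Data.List.Relation.Unary.Any.Properties using (any⁻)
open import Data.Nat
open import Data.Nat.Properties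
open import Data.Nat.Tactic.RingSolver using (solve-∀)
open import Data.Product using (Σ; ∃; ∃₂; _×_; _,_; proj₁; proj₂; map₁)
open import Data.Sum using (_⊎_; inj₁; inj₂)
open import Function using (_∘_)
open import Function.Bundles using (Equivalence)
open import Relation.Binary.PropositionalEquality
open import Relation.Nullary using (¬_; yes; no; does)

pattern 0F = Fin.zero
pattern 1F = Fin.suc Fin.zero
pattern 2F = Fin.suc (Fin.suc Fin.zero)

∸-<-+ : ∀ {s q ℓ} → s ≤ q → q < s + ℓ → q ∸ s < ℓ
∸-<-+ {s} {q} {ℓ} s≤q q<s+ℓ = subst (q ∸ s <_) (m+n∸m≡n s ℓ) (∸-monoˡ-< q<s+ℓ s≤q)

+-≤-∸ : ∀ {s ℓ q} → s + ℓ ≤ q → ℓ ≤ q ∸ s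
+-≤-∸ {s} {ℓ} {q} s+ℓ≤q = m+n≤o⇒m≤o∸n ℓ (subst (_≤ q) (+-comm s ℓ) s+ℓ≤q)

thrice : ∀ x → x + x + x ≡ 3 * x
thrice = solve-∀

∸-< : ∀ {k Q h} → k ≤ Q → Q < h + k → Q ∸ k < h
∸-< {k} {Q} {h} k≤Q Q<h+k = +-cancelʳ-< k (Q ∸ k) h (subst (_< h + k) (sym (m∸n+n≡m k≤Q)) Q<h+k)

recombine : ∀ {x c Q} a b r → a + b ≡ r + 3 * c → x + c ≤ Q → 3 * x + a + (3 * (Q ∸ (x + c)) + b) ≡ 3 * Q + r
recombine {x} {c} {Q} a b r a+b≡r+3c x+c≤Q = begin
  3 * x + a + (3 * y + b)    ≡⟨ regroup₁ x a y b ⟩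
  3 * x + 3 * y + (a + b)    ≡⟨ cong (3 * x + 3 * y +_) a+b≡r+3c ⟩
  3 * x + 3 * y + (r + 3 * c) ≡⟨ regroup₂ x y r c ⟩
  3 * (x + c + y) + r        ≡⟨ cong (λ z → 3 * z + r) (m+[n∸m]≡n x+c≤Q) ⟩
  3 * Q + r                  ∎
  where
  open ≡-Reasoning
  y = Q ∸ (x + c)
  regroup₁ : ∀ x a y b → 3 * x + a + (3 * y + b) ≡ 3 * x + 3 * y + (a + b)
  regroup₁ = solve-∀
  regroup₂ : ∀ x y r c → 3 * x + 3 * y + (r + 3 * c) ≡ 3 * (x + c + y) + r
  regroup₂ = solve-∀

∧₁ : ∀ {a b} → T (a ∧ b) → T a
∧₁ {true} _ = _

∧₂ : ∀ a {b} → T (a ∧ b) → T b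
∧₂ true p = p

∨-split : ∀ a {b} → T (a ∨ b) → T a ⊎ T b
∨-split true  p = inj₁ p
∨-split false p = inj₂ p

not-≡ᵇ-refl : ∀ m → T (not (m ≡ᵇ m)) → ⊥
not-≡ᵇ-refl m p with m ≡ᵇ m | ≡⇒≡ᵇ m m refl
... | true | _ = p

if-<ᵇ-then : ∀ {A : Set} {m n} {x y : A} → m < n → (if m <ᵇ n then x else y) ≡ x
if-<ᵇ-then {m = m} {n} m<n with m <ᵇ n | <⇒<ᵇ m<n
... | true | _ = refl

if-<ᵇ-else : ∀ {A : Set} {m n} {x y : A} → n ≤ m → (if m <ᵇ n then x else y) ≡ y
if-<ᵇ-else {m = m} {n} n≤m with m <ᵇ n in eq
... | true  = ⊥-elim (<⇒≱ (<ᵇ⇒< m n (Equivalence.from T-≡ eq)) n≤m)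
... | false = refl

indicator : Bool → ℕ
indicator true  = 1
indicator false = 0

count : (ℕ → Bool) → ℕ → ℕ
count p zero    = 0
count p (suc n) = indicator (p 0) + count (p ∘ suc) n

count-cong : ∀ {p q} n → (∀ i → i < n → p i ≡ q i) → count p n ≡ count q n
count-cong zero    eq = refl
count-cong (suc n) eq =
  cong₂ _+_ (cong indicator (eq 0 z<s)) (count-cong n (λ i i<n → eq (suc i) (s<s i<n)))

count-+ : ∀ p m n → count p (m + n) ≡ count p m + count (λ i → p (m + i)) n
count-+ p zero    n = refl
count-+ p (suc m) n =
  trans (cong (indicator (p 0) +_) (count-+ (p ∘ suc) m n)) (sym (+-assoc (indicator (p 0)) _ _))

count-const : ∀ b n → count (λ _ → b) n ≡ indicator b * n
count-const b zero    = sym (*-zeroʳ (indicator b))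
count-const b (suc n) = trans (cong (indicator b +_) (count-const b n)) (sym (*-suc (indicator b) n))

count-residues : ∀ p M →
  count p (3 * M) ≡ count (λ q → p (3 * q + 0)) M + count (λ q → p (3 * q + 1)) M + count (λ q → p (3 * q + 2)) M
count-residues p zero    = refl
count-residues p (suc M) = begin
  count p (3 * suc M)                                   ≡⟨ cong (count p) (*-suc 3 M) ⟩
  indicator (p 0) + (indicator (p 1) + (indicator (p 2) + count (λ i → p (3 + i)) (3 * M)))
    ≡⟨ cong (λ x → indicator (p 0) + (indicator (p 1) + (indicator (p 2) + x))) (count-residues (λ i → p (3 + i)) M) ⟩
  indicator (p 0) + (indicator (p 1) + (indicator (p 2) + (r₀ + r₁ + r₂)))
    ≡⟨ regroup (indicator (p 0)) (indicator (p 1)) (indicator (p 2)) r₀ r₁ r₂ ⟩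
  (indicator (p 0) + r₀) + (indicator (p 1) + r₁) + (indicator (p 2) + r₂)
    ≡⟨ cong₂ _+_ (cong₂ _+_ (shift 0) (shift 1)) (shift 2) ⟩
  count (λ q → p (3 * q + 0)) (suc M) + count (λ q → p (3 * q + 1)) (suc M) + count (λ q → p (3 * q + 2)) (suc M) ∎
  where
  open ≡-Reasoning
  r₀ = count (λ q → p (3 + (3 * q + 0))) M
  r₁ = count (λ q → p (3 + (3 * q + 1))) M
  r₂ = count (λ q → p (3 + (3 * q + 2))) M
  regroup : ∀ a b c x y z → a + (b + (c + (x + y + z))) ≡ (a + x) + (b + y) + (c + z)
  regroup = solve-∀
  shift : ∀ ρ → indicator (p ρ) + count (λ q → p (3 + (3 * q + ρ))) M ≡ count (λ q → p (3 * q + ρ)) (suc M)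
  shift ρ = cong₂ _+_ refl (count-cong M (λ q _ → cong p (cong (_+ ρ) (sym (*-suc 3 q)))))

length-filter-tabulate : ∀ {A : Set} n (g : Fin n → A) (q : A → Bool) (p : ℕ → Bool) →
  (∀ i → q (g i) ≡ p (toℕ i)) → length (filter (T? ∘ q) (tabulate g)) ≡ count p n
length-filter-tabulate zero    g q p eq = refl
length-filter-tabulate (suc n) g q p eq
  rewrite eq Fin.zero
  with p 0
... | true  = cong suc (length-filter-tabulate n (g ∘ Fin.suc) q (p ∘ suc) (eq ∘ Fin.suc))
... | false = length-filter-tabulate n (g ∘ Fin.suc) q (p ∘ suc) (eq ∘ Fin.suc)

count-false : ∀ {p} n → (∀ i → i < n → p i ≡ false) → count p n ≡ 0
count-false n all-false = trans (count-cong n all-false) (count-const false n)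

-- Circulant graphs

-- S is a subset of ℤ/n given by its members in [0, n); a sum landing on D is a + b ∈ {D, D + n}.
-- Sum-freeness is required only below n: with symmetry it implies sum-freeness modulo n.
record CompleteSumFreeSet (n d : ℕ) : Set where
  field
    S          : ℕ → Bool
    S-0        : S 0 ≡ false
    S-<        : ∀ {D} → S D ≡ true → D < n
    S-reflect  : ∀ {D} → S D ≡ true → S (n ∸ D) ≡ true
    S-sum-free : ∀ {a b} → S a ≡ true → S b ≡ true → S (a + b) ≡ true → ⊥
    S-complete : ∀ {D} → 0 < D → D < n → S D ≡ false →
                 ∃₂ λ a b → S a ≡ true × S b ≡ true × (a + b ≡ D ⊎ a + b ≡ D + n)
    S-count    : count S n ≡ d

module _ {n d : ℕ} (C : CompleteSumFreeSet n d) where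

  open CompleteSumFreeSet C

  S-reflect-≡ : ∀ {D} → D ≤ n → S (n ∸ D) ≡ S D
  S-reflect-≡ {D} D≤n with S D in SD | S (n ∸ D) in SnD
  ... | true  | _     = trans (sym SnD) (S-reflect SD)
  ... | false | false = refl
  ... | false | true  = sym (trans (sym SD) (subst (λ x → S x ≡ true) (m∸[m∸n]≡n D≤n) (S-reflect SnD)))

  record Edge (x y : ℕ) : Set where
    constructor edge
    field S-∣x-y∣ : S ∣ x - y ∣ ≡ true

  edge-sym : ∀ {x y} → Edge x y → Edge y x
  edge-sym {x} {y} (edge e) = edge (subst (λ z → S z ≡ true) (∣-∣-comm x y) e)

  edge-+ : ∀ {x d} → S d ≡ true → Edge x (x + d)
  edge-+ {x} {d} Sd = edge (subst (λ z → S z ≡ true) (sym (∣m-m+n∣≡n x d)) Sd)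

  edge-+⁻ : ∀ {x d} → Edge x (x + d) → S d ≡ true
  edge-+⁻ {x} {d} (edge e) = subst (λ z → S z ≡ true) (∣m-m+n∣≡n x d) e

  no-sorted-triangle : ∀ {x y z} → x ≤ y → y ≤ z → Edge x y → Edge y z → Edge x z → ⊥
  no-sorted-triangle {x} x≤y y≤z exy eyz exz
    with m≤n⇒∃[o]m+o≡n x≤y | m≤n⇒∃[o]m+o≡n y≤z
  ... | d₁ , refl | d₂ , refl =
    S-sum-free (edge-+⁻ exy) (edge-+⁻ eyz) (edge-+⁻ (subst (Edge x) (+-assoc x d₁ d₂) exz))

  no-triangle : ∀ x y z → Edge x y → Edge y z → Edge x z → ⊥
  no-triangle x y z exy eyz exz with ≤-total x y | ≤-total y z | ≤-total x z
  ... | inj₁ x≤y | inj₁ y≤z | _        = no-sorted-triangle x≤y y≤z exy eyz exz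
  ... | inj₁ x≤y | inj₂ z≤y | inj₁ x≤z = no-sorted-triangle x≤z z≤y exz (edge-sym eyz) exy
  ... | inj₁ x≤y | inj₂ z≤y | inj₂ z≤x = no-sorted-triangle z≤x x≤y (edge-sym exz) exy (edge-sym eyz)
  ... | inj₂ y≤x | inj₁ y≤z | inj₁ x≤z = no-sorted-triangle y≤x x≤z (edge-sym exy) exz eyz
  ... | inj₂ y≤x | inj₁ y≤z | inj₂ z≤x = no-sorted-triangle y≤z z≤x eyz (edge-sym exz) (edge-sym exy)
  ... | inj₂ y≤x | inj₂ z≤y | _        = no-sorted-triangle z≤y y≤x (edge-sym eyz) (edge-sym exy) (edge-sym exz)

  CommonNeighbour : ℕ → ℕ → Set
  CommonNeighbour x y = ∃ λ w → w < n × Edge x w × Edge w y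

  neighbour-sum : ∀ {x D a b} → x + D < n → S a ≡ true → S b ≡ true → a + b ≡ D → CommonNeighbour x (x + D)
  neighbour-sum {x} {D} {a} {b} x+D<n Sa Sb a+b≡D =
    x + a , ≤-<-trans (+-monoʳ-≤ x a≤D) x+D<n , edge-+ Sa ,
    subst (Edge (x + a)) (trans (+-assoc x a b) (cong (x +_) a+b≡D)) (edge-+ Sb)
    where a≤D = subst (a ≤_) a+b≡D (m≤m+n a b)

  neighbour-above : ∀ {x D a b} → x + a < n → S a ≡ true → S b ≡ true → a + b ≡ D + n → CommonNeighbour x (x + D)
  neighbour-above {x} {D} {a} {b} x+a<n Sa Sb a+b≡D+n =
    x + a , x+a<n , edge-+ Sa , edge-sym (subst (Edge (x + D)) x+D+[n∸b]≡x+a (edge-+ (S-reflect Sb)))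
    where
    open ≡-Reasoning
    x+D+[n∸b]≡x+a : x + D + (n ∸ b) ≡ x + a
    x+D+[n∸b]≡x+a = trans (+-assoc x D (n ∸ b)) (cong (x +_) (+-cancelʳ-≡ b _ _ (begin
      D + (n ∸ b) + b ≡⟨ +-assoc D (n ∸ b) b ⟩
      D + (n ∸ b + b) ≡⟨ cong (D +_) (m∸n+n≡m (<⇒≤ (S-< Sb))) ⟩
      D + n           ≡⟨ sym a+b≡D+n ⟩
      a + b           ∎)))

  neighbour-wrapped : ∀ {x D a b} → x + D < n → n ≤ x + a → S a ≡ true → S b ≡ true → a + b ≡ D + n →
                      CommonNeighbour x (x + D)
  neighbour-wrapped {x} {D} {a} {b} x+D<n n≤x+a Sa Sb a+b≡D+n =
    w , <-trans w<x (m+n≤o⇒m≤o (suc x) x+D<n) ,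
    edge-sym (subst (Edge w) w+[n∸a]≡x (edge-+ (S-reflect Sa))) ,
    subst (Edge w) w+b≡x+D (edge-+ Sb)
    where
    open ≡-Reasoning
    w = x + a ∸ n
    w+n≡x+a : w + n ≡ x + a
    w+n≡x+a = m∸n+n≡m n≤x+a
    w<x : w < x
    w<x = +-cancelʳ-< n w x (subst (_< x + n) (sym w+n≡x+a) (+-monoʳ-< x (S-< Sa)))
    w+[n∸a]≡x : w + (n ∸ a) ≡ x
    w+[n∸a]≡x = +-cancelʳ-≡ a _ _ (begin
      w + (n ∸ a) + a ≡⟨ +-assoc w (n ∸ a) a ⟩
      w + (n ∸ a + a) ≡⟨ cong (w +_) (m∸n+n≡m (<⇒≤ (S-< Sa))) ⟩
      w + n           ≡⟨ w+n≡x+a ⟩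
      x + a           ∎)
    w+b≡x+D : w + b ≡ x + D
    w+b≡x+D = +-cancelʳ-≡ n _ _ (begin
      w + b + n   ≡⟨ +-assoc w b n ⟩
      w + (b + n) ≡⟨ cong (w +_) (+-comm b n) ⟩
      w + (n + b) ≡⟨ sym (+-assoc w n b) ⟩
      w + n + b   ≡⟨ cong (_+ b) w+n≡x+a ⟩
      x + a + b   ≡⟨ +-assoc x a b ⟩
      x + (a + b) ≡⟨ cong (x +_) a+b≡D+n ⟩
      x + (D + n) ≡⟨ sym (+-assoc x D n) ⟩
      x + D + n   ∎)

  common-neighbour-+ : ∀ x D → x + D < n → 0 < D → S D ≡ false → CommonNeighbour x (x + D)
  common-neighbour-+ x D x+D<n D>0 SD with S-complete D>0 (≤-<-trans (m≤n+m D x) x+D<n) SD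
  ... | a , b , Sa , Sb , inj₁ a+b≡D = neighbour-sum x+D<n Sa Sb a+b≡D
  ... | a , b , Sa , Sb , inj₂ a+b≡D+n with x + a <? n
  ...   | yes x+a<n = neighbour-above x+a<n Sa Sb a+b≡D+n
  ...   | no  x+a≮n = neighbour-wrapped x+D<n (≮⇒≥ x+a≮n) Sa Sb a+b≡D+n

  common-neighbour-≤ : ∀ {x y} → x ≤ y → y < n → x ≢ y → S ∣ x - y ∣ ≡ false → CommonNeighbour x y
  common-neighbour-≤ {x} x≤y y<n x≢y Sxy with m≤n⇒∃[o]m+o≡n x≤y
  ... | zero  , refl = ⊥-elim (x≢y (sym (+-identityʳ x)))
  ... | suc D , refl = common-neighbour-+ x (suc D) y<n z<s (trans (cong S (sym (∣m-m+n∣≡n x (suc D)))) Sxy)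

  common-neighbour : ∀ {x y} → x < n → y < n → x ≢ y → S ∣ x - y ∣ ≡ false → CommonNeighbour x y
  common-neighbour {x} {y} x<n y<n x≢y Sxy with ≤-total x y
  ... | inj₁ x≤y = common-neighbour-≤ x≤y y<n x≢y Sxy
  ... | inj₂ y≤x with common-neighbour-≤ y≤x x<n (x≢y ∘ sym) (trans (cong S (∣-∣-comm y x)) Sxy)
  ...   | w , w<n , e₁ , e₂ = w , w<n , edge-sym e₂ , edge-sym e₁

  count-distances : ∀ {v} → v < n → count (λ u → S ∣ v - u ∣) n ≡ count S n
  count-distances {v} v<n = begin
    count (λ u → S ∣ v - u ∣) n                                    ≡⟨ cong (count _) (sym v+m≡n) ⟩
    count (λ u → S ∣ v - u ∣) (v + m)                              ≡⟨ count-+ _ v m ⟩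
    count (λ u → S ∣ v - u ∣) v + count (λ i → S ∣ v - v + i ∣) m  ≡⟨ cong₂ _+_ (count-cong v below) (count-cong m above) ⟩
    count (λ u → S (m + u)) v + count S m                          ≡⟨ +-comm _ (count S m) ⟩
    count S m + count (λ u → S (m + u)) v                          ≡⟨ sym (count-+ S m v) ⟩
    count S (m + v)                                                ≡⟨ cong (count S) (trans (+-comm m v) v+m≡n) ⟩
    count S n                                                      ∎
    where
    open ≡-Reasoning
    m = n ∸ v
    v+m≡n : v + m ≡ n
    v+m≡n = m+[n∸m]≡n (<⇒≤ v<n)
    n∸[v∸u]≡m+u : ∀ {u} → u ≤ v → n ∸ (v ∸ u) ≡ m + u
    n∸[v∸u]≡m+u {u} u≤v = begin
      n ∸ (v ∸ u)                   ≡⟨ cong (_∸ (v ∸ u)) (sym v+m≡n) ⟩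
      v + m ∸ (v ∸ u)               ≡⟨ cong (λ z → z + m ∸ (v ∸ u)) (sym (m∸n+n≡m u≤v)) ⟩
      (v ∸ u) + u + m ∸ (v ∸ u)     ≡⟨ cong (_∸ (v ∸ u)) (+-assoc (v ∸ u) u m) ⟩
      (v ∸ u) + (u + m) ∸ (v ∸ u)   ≡⟨ m+n∸m≡n (v ∸ u) (u + m) ⟩
      u + m                         ≡⟨ +-comm u m ⟩
      m + u                         ∎
    below : ∀ u → u < v → S ∣ v - u ∣ ≡ S (m + u)
    below u u<v = begin
      S ∣ v - u ∣       ≡⟨ cong S (m≤n⇒∣n-m∣≡n∸m (<⇒≤ u<v)) ⟩
      S (v ∸ u)         ≡⟨ sym (S-reflect-≡ (≤-trans (m∸n≤m v u) (<⇒≤ v<n))) ⟩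
      S (n ∸ (v ∸ u))   ≡⟨ cong S (n∸[v∸u]≡m+u (<⇒≤ u<v)) ⟩
      S (m + u)         ∎
    above : ∀ i → i < m → S ∣ v - v + i ∣ ≡ S i
    above i _ = cong S (∣m-m+n∣≡n v i)

  circulant : Graph n
  circulant = record
    { adj       = λ u v → S ∣ toℕ u - toℕ v ∣
    ; symmetric = λ u v → cong S (∣-∣-comm (toℕ u) (toℕ v))
    ; loopless  = λ v → trans (cong S (∣n-n∣≡0 (toℕ v))) S-0
    }

  circulant-K3Saturated : K3Saturated circulant
  circulant-K3Saturated = triangle-free , saturated
    where
    triangle-free : TriangleFree circulant
    triangle-free u v w uv vw uw = no-triangle (toℕ u) (toℕ v) (toℕ w) (edge uv) (edge vw) (edge uw)
    saturated : ∀ u v → u ≢ v → ¬ Adj circulant u v → ∃ λ w → Adj circulant u w × Adj circulant w v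
    saturated u v u≢v ¬uv
      with common-neighbour (toℕ<n u) (toℕ<n v) (u≢v ∘ toℕ-injective) (¬-not ¬uv)
    ... | w , w<n , edge uw , edge wv =
      fromℕ< w<n ,
      subst (λ z → S ∣ toℕ u - z ∣ ≡ true) (sym (toℕ-fromℕ< w<n)) uw ,
      subst (λ z → S ∣ z - toℕ v ∣ ≡ true) (sym (toℕ-fromℕ< w<n)) wv

  circulant-regular : Regular circulant d
  circulant-regular v = begin
    degree circulant v             ≡⟨ length-filter-tabulate n (λ u → u) _ _ (λ _ → refl) ⟩
    count (λ u → S ∣ toℕ v - u ∣) n ≡⟨ count-distances (toℕ<n v) ⟩
    count S n                      ≡⟨ S-count ⟩
    d                              ∎
    where open ≡-Reasoning

-- Affine forms in the family parameter

infixl 6 _⊕_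
data Affine : Set where
  cst : ℕ → Affine
  _·t : ℕ → Affine
  _⊕_ : Affine → Affine → Affine

aff : ℕ → ℕ → Affine
aff c s = cst c ⊕ s ·t

⟦_⟧ : Affine → ℕ → ℕ
⟦ cst c ⟧ t = c
⟦ s ·t  ⟧ t = s * t
⟦ a ⊕ b ⟧ t = ⟦ a ⟧ t + ⟦ b ⟧ t

constant slope : Affine → ℕ
constant (cst c) = c
constant (s ·t)  = 0
constant (a ⊕ b) = constant a + constant b
slope (cst c) = 0
slope (s ·t)  = s
slope (a ⊕ b) = slope a + slope b

⟦⟧-normal : ∀ a t → ⟦ a ⟧ t ≡ constant a + slope a * t
⟦⟧-normal (cst c) t = sym (+-identityʳ c)
⟦⟧-normal (s ·t)  t = refl
⟦⟧-normal (a ⊕ b) t = begin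
  ⟦ a ⟧ t + ⟦ b ⟧ t                                              ≡⟨ cong₂ _+_ (⟦⟧-normal a t) (⟦⟧-normal b t) ⟩
  constant a + slope a * t + (constant b + slope b * t)         ≡⟨ regroup (constant a) (slope a) (constant b) (slope b) t ⟩
  constant a + constant b + (slope a + slope b) * t             ∎
  where
  open ≡-Reasoning
  regroup : ∀ c s c′ s′ t → c + s * t + (c′ + s′ * t) ≡ c + c′ + (s + s′) * t
  regroup = solve-∀

infix 4 _≤ᴬ_
_≤ᴬ_ : Affine → Affine → Bool
a ≤ᴬ b = (constant a ≤ᵇ constant b) ∧ (slope a ≤ᵇ slope b)

≤ᴬ-sound : ∀ a b → T (a ≤ᴬ b) → ∀ t → ⟦ a ⟧ t ≤ ⟦ b ⟧ t
≤ᴬ-sound a b a≤b t with Equivalence.to (T-∧ {constant a ≤ᵇ constant b}) a≤b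
... | c≤c′ , s≤s′ = begin
  ⟦ a ⟧ t                     ≡⟨ ⟦⟧-normal a t ⟩
  constant a + slope a * t    ≤⟨ +-mono-≤ (≤ᵇ⇒≤ (constant a) (constant b) c≤c′) (*-monoˡ-≤ t (≤ᵇ⇒≤ (slope a) (slope b) s≤s′)) ⟩
  constant b + slope b * t    ≡⟨ sym (⟦⟧-normal b t) ⟩
  ⟦ b ⟧ t                     ∎
  where open ≤-Reasoning

quotRem₃ : ℕ → ℕ × Fin 3
quotRem₃ 0 = 0 , 0F
quotRem₃ 1 = 0 , 1F
quotRem₃ 2 = 0 , 2F
quotRem₃ (suc (suc (suc D))) = map₁ suc (quotRem₃ D)

quotRem₃-correct : ∀ D → D ≡ 3 * proj₁ (quotRem₃ D) + toℕ (proj₂ (quotRem₃ D))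
quotRem₃-correct 0 = refl
quotRem₃-correct 1 = refl
quotRem₃-correct 2 = refl
quotRem₃-correct (suc (suc (suc D))) =
  trans (cong (3 +_) (quotRem₃-correct D)) (three-more (proj₁ (quotRem₃ D)) (toℕ (proj₂ (quotRem₃ D))))
  where
  three-more : ∀ q r → 3 + (3 * q + r) ≡ 3 * suc q + r
  three-more = solve-∀

quotRem₃-canonical : ∀ q ρ → quotRem₃ (3 * q + toℕ ρ) ≡ (q , ρ)
quotRem₃-canonical zero 0F = refl
quotRem₃-canonical zero 1F = refl
quotRem₃-canonical zero 2F = refl
quotRem₃-canonical (suc q) ρ =
  trans (cong quotRem₃ (three-more q (toℕ ρ))) (cong (map₁ suc) (quotRem₃-canonical q ρ))
  where
  three-more : ∀ q r → 3 * suc q + r ≡ 3 + (3 * q + r)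
  three-more = solve-∀

+-canonical : ∀ q₁ q₂ (ρ₁ ρ₂ : Fin 3) →
  3 * (q₁ + q₂ + proj₁ (quotRem₃ (toℕ ρ₁ + toℕ ρ₂))) + toℕ (proj₂ (quotRem₃ (toℕ ρ₁ + toℕ ρ₂))) ≡
  3 * q₁ + toℕ ρ₁ + (3 * q₂ + toℕ ρ₂)
+-canonical q₁ q₂ ρ₁ ρ₂ = begin
  3 * (q₁ + q₂ + c) + toℕ r                 ≡⟨ regroup q₁ q₂ c (toℕ r) ⟩
  3 * q₁ + 3 * q₂ + (3 * c + toℕ r)         ≡⟨ cong (3 * q₁ + 3 * q₂ +_) (sym (quotRem₃-correct (toℕ ρ₁ + toℕ ρ₂))) ⟩
  3 * q₁ + 3 * q₂ + (toℕ ρ₁ + toℕ ρ₂)       ≡⟨ regroup′ q₁ q₂ (toℕ ρ₁) (toℕ ρ₂) ⟩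
  3 * q₁ + toℕ ρ₁ + (3 * q₂ + toℕ ρ₂)       ∎
  where
  open ≡-Reasoning
  c = proj₁ (quotRem₃ (toℕ ρ₁ + toℕ ρ₂))
  r = proj₂ (quotRem₃ (toℕ ρ₁ + toℕ ρ₂))
  regroup : ∀ q₁ q₂ c r → 3 * (q₁ + q₂ + c) + r ≡ 3 * q₁ + 3 * q₂ + (3 * c + r)
  regroup = solve-∀
  regroup′ : ∀ q₁ q₂ ρ₁ ρ₂ → 3 * q₁ + 3 * q₂ + (ρ₁ + ρ₂) ≡ 3 * q₁ + ρ₁ + (3 * q₂ + ρ₂)
  regroup′ = solve-∀

canonical-injective : ∀ {q q′ ρ ρ′} → 3 * q + toℕ ρ ≡ 3 * q′ + toℕ ρ′ → q ≡ q′ × ρ ≡ ρ′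
canonical-injective {q} {q′} {ρ} {ρ′} eq with
  trans (sym (quotRem₃-canonical q ρ)) (trans (cong quotRem₃ eq) (quotRem₃-canonical q′ ρ′))
... | refl = refl , refl

-- Layouts

-- A layout describes a set S of numbers below n = 3 · quotient + remainder. For each residue ρ
-- the quotients q of the numbers 3q + ρ are tiled by consecutive runs. The cell of a run says
-- that its numbers are members of S, or excluded (only 0 is), or nonmembers D with
-- a + b = D (a + b = D + n if the summand wraps) for the member a = 3 · quot + rem and a
-- member b that the checks below locate.
record Summand : Set where
  constructor summand
  field
    quot  : Affine
    rem   : Fin 3
    wraps : Bool

data Cell : Set where
  member    : Cell
  nonmember : Summand → Cell
  excluded  : Cell

isMember : Cell → Bool
isMember member = true
isMember _      = false

record Run : Set where
  constructor run
  field
    span : Affine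
    cell : Cell

total : List Run → Affine
total []             = cst 0
total (run ℓ _ ∷ rs) = ℓ ⊕ total rs

memberLength : List Run → Affine
memberLength []             = cst 0
memberLength (run ℓ c ∷ rs) = (if isMember c then ℓ else cst 0) ⊕ memberLength rs

-- The numbers 3q + res with lo ≤ q < hi.
record Block : Set where
  constructor block
  field
    res   : Fin 3
    lo hi : Affine
    cell  : Cell

blocksFrom : Fin 3 → Affine → List Run → List Block
blocksFrom ρ s []             = []
blocksFrom ρ s (run ℓ c ∷ rs) = block ρ s (s ⊕ ℓ) c ∷ blocksFrom ρ (s ⊕ ℓ) rs

record Layout : Set where
  field
    quotient  : Affine
    remainder : Fin 3
    runs      : Fin 3 → List Run

  order : Affine
  order = quotient ⊕ quotient ⊕ quotient ⊕ cst (toℕ remainder)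

  blocks : List Block
  blocks = concatMap (λ ρ → blocksFrom ρ (cst 0) (runs ρ)) (allFin 3)

  members : List Block
  members = filterᵇ (isMember ∘ Block.cell) blocks

module Checks (L : Layout) where

  open Layout L
  open Block

  tripled : Fin 3 → Affine
  tripled ρ = total (runs ρ) ⊕ total (runs ρ) ⊕ total (runs ρ) ⊕ cst (toℕ ρ)

  -- The runs of residue ρ cover exactly the numbers 3q + ρ below n.
  coveredᵇ : Fin 3 → Bool
  coveredᵇ ρ = (order ≤ᴬ tripled ρ) ∧ (tripled ρ ≤ᴬ order ⊕ cst 2)

  avoidsZeroᵇ : Block → Bool
  avoidsZeroᵇ β = not (toℕ (res β) ≡ᵇ 0) ∨ (cst 1 ≤ᴬ lo β)

  -- As res β₁ + res β₂ = 3 · carry + sumRes, numbers of β₁ and β₂ with quotients q₁ and q₂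
  -- add up to a number with quotient q₁ + q₂ + carry.
  carry : Block → Block → ℕ
  carry β₁ β₂ = proj₁ (quotRem₃ (toℕ (res β₁) + toℕ (res β₂)))

  sumRes : Block → Block → Fin 3
  sumRes β₁ β₂ = proj₂ (quotRem₃ (toℕ (res β₁) + toℕ (res β₂)))

  disjointSumᵇ : ℕ → Block → Block → Block → Bool
  disjointSumᵇ c β₁ β₂ β₃ = (hi β₃ ≤ᴬ lo β₁ ⊕ lo β₂ ⊕ cst c) ∨ (hi β₁ ⊕ hi β₂ ⊕ cst c ≤ᴬ lo β₃ ⊕ cst 1)

  sumFreeᵇ : Block → Block → Block → Bool
  sumFreeᵇ β₁ β₂ β₃ = not (toℕ (sumRes β₁ β₂) ≡ᵇ toℕ (res β₃)) ∨ disjointSumᵇ (carry β₁ β₂) β₁ β₂ β₃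

  -- If res β + res β′ = remainder + 3c, then n ∸ (3q + res β) = 3 (quotient ∸ (q + c)) + res β′,
  -- and the inequalities put this quotient in β′ for every q in β.
  reflectsᵇ : ℕ → Block → Block → Bool
  reflectsᵇ c β β′ =
    (toℕ (res β) + toℕ (res β′) ≡ᵇ toℕ remainder + 3 * c) ∧
    (lo β′ ⊕ cst c ⊕ hi β ≤ᴬ quotient ⊕ cst 1) ∧
    (quotient ⊕ cst 1 ≤ᴬ hi β′ ⊕ lo β ⊕ cst c)

  containsᵇ : Summand → Block → Bool
  containsᵇ (summand qa ρa _) β = (toℕ ρa ≡ᵇ toℕ (res β)) ∧ (lo β ≤ᴬ qa) ∧ (qa ⊕ cst 1 ≤ᴬ hi β)

  -- The numbers D of β, or D + n if the summand wraps, as a block.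
  target : Summand → Block → Block
  target (summand _ _ false) β = β
  target (summand _ _ true) (block ρ l h c) =
    block (proj₂ k,r) (l ⊕ quotient ⊕ cst (proj₁ k,r)) (h ⊕ quotient ⊕ cst (proj₁ k,r)) c
    where k,r = quotRem₃ (toℕ ρ + toℕ remainder)

  -- Subtracting a = 3 · quot + rem (borrowing c) from the numbers of τ lands in β.
  complementsᵇ : ℕ → Summand → Block → Block → Bool
  complementsᵇ c (summand qa ρa _) τ β =
    (toℕ ρa + toℕ (res β) ≡ᵇ toℕ (res τ) + 3 * c) ∧
    (lo β ⊕ qa ⊕ cst c ≤ᴬ lo τ) ∧
    (hi τ ≤ᴬ hi β ⊕ qa ⊕ cst c)

  justifiedᵇ : Block → Bool
  justifiedᵇ (block ρ l h member)        = true
  justifiedᵇ (block ρ l h excluded)      = (toℕ ρ ≡ᵇ 0) ∧ (h ≤ᴬ cst 1)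
  justifiedᵇ β@(block ρ l h (nonmember w)) =
    any (containsᵇ w) members ∧
    any (λ β′ → complementsᵇ 0 w (target w β) β′ ∨ complementsᵇ 1 w (target w β) β′) members

  size : Affine
  size = memberLength (runs 0F) ⊕ memberLength (runs 1F) ⊕ memberLength (runs 2F)

  valid : Affine → Bool
  valid d =
    all coveredᵇ (allFin 3) ∧
    all avoidsZeroᵇ members ∧
    all (λ β₁ → all (λ β₂ → all (sumFreeᵇ β₁ β₂) members) members) members ∧
    all (λ β → any (λ β′ → reflectsᵇ 0 β β′ ∨ reflectsᵇ 1 β β′) members) members ∧
    all justifiedᵇ blocks ∧
    (size ≤ᴬ d) ∧ (d ≤ᴬ size)

module Semantics (L : Layout) (t : ℕ) where

  open Layout L
  open Checks L
  open Block

  ⟪_⟫ : Affine → ℕ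
  ⟪ a ⟫ = ⟦ a ⟧ t

  ≤ᴬ⇒≤ : ∀ a b → T (a ≤ᴬ b) → ⟪ a ⟫ ≤ ⟪ b ⟫
  ≤ᴬ⇒≤ a b a≤b = ≤ᴬ-sound a b a≤b t

  n : ℕ
  n = ⟪ order ⟫

  n≡ : n ≡ 3 * ⟪ quotient ⟫ + toℕ remainder
  n≡ = cong (_+ toℕ remainder) (thrice ⟪ quotient ⟫)

  walk : List Run → ℕ → Cell
  walk []             q = excluded
  walk (run ℓ c ∷ rs) q = if q <ᵇ ⟪ ℓ ⟫ then c else walk rs (q ∸ ⟪ ℓ ⟫)

  S : ℕ → Bool
  S D = isMember (walk (runs (proj₂ (quotRem₃ D))) (proj₁ (quotRem₃ D)))

  S-canonical : ∀ q ρ → S (3 * q + toℕ ρ) ≡ isMember (walk (runs ρ) q)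
  S-canonical q ρ rewrite quotRem₃-canonical q ρ = refl

  InRange : ℕ → Block → Set
  InRange q β = ⟪ lo β ⟫ ≤ q × q < ⟪ hi β ⟫

  record Located (D : ℕ) (bs : List Block) : Set where
    constructor located
    field
      {quot}   : ℕ
      {place}  : Block
      place∈   : place ∈ bs
      D≡       : D ≡ 3 * quot + toℕ (res place)
      in-range : InRange quot place

  blocksFrom-lo : ∀ {ρ s rs β} → β ∈ blocksFrom ρ s rs → ⟪ s ⟫ ≤ ⟪ lo β ⟫
  blocksFrom-lo {rs = run ℓ c ∷ rs} (here refl)  = ≤-refl
  blocksFrom-lo {s = s} {rs = run ℓ c ∷ rs} (there β∈) =
    ≤-trans (m≤m+n ⟪ s ⟫ ⟪ ℓ ⟫) (blocksFrom-lo β∈)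

  blocksFrom-res : ∀ {ρ s rs β} → β ∈ blocksFrom ρ s rs → res β ≡ ρ
  blocksFrom-res {rs = run ℓ c ∷ rs} (here refl) = refl
  blocksFrom-res {rs = run ℓ c ∷ rs} (there β∈) = blocksFrom-res β∈

  walk-block : ∀ {ρ s rs β q} → β ∈ blocksFrom ρ s rs → InRange q β → walk rs (q ∸ ⟪ s ⟫) ≡ cell β
  walk-block {rs = run ℓ c ∷ rs} (here refl) (s≤q , q<s+ℓ) =
    if-<ᵇ-then (∸-<-+ s≤q q<s+ℓ)
  walk-block {s = s} {run ℓ c ∷ rs} {q = q} (there β∈) in-range = begin
    walk (run ℓ c ∷ rs) (q ∸ ⟪ s ⟫) ≡⟨ if-<ᵇ-else (+-≤-∸ {⟪ s ⟫} s+ℓ≤q) ⟩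
    walk rs (q ∸ ⟪ s ⟫ ∸ ⟪ ℓ ⟫)     ≡⟨ cong (walk rs) (∸-+-assoc q ⟪ s ⟫ ⟪ ℓ ⟫) ⟩
    walk rs (q ∸ ⟪ s ⊕ ℓ ⟫)         ≡⟨ walk-block β∈ in-range ⟩
    _                               ∎
    where
    open ≡-Reasoning
    s+ℓ≤q : ⟪ s ⟫ + ⟪ ℓ ⟫ ≤ q
    s+ℓ≤q = ≤-trans (blocksFrom-lo β∈) (proj₁ in-range)

  walk-locate : ∀ {ρ} s rs {q} → ⟪ s ⟫ ≤ q → q < ⟪ s ⟫ + ⟪ total rs ⟫ →
                ∃ λ β → β ∈ blocksFrom ρ s rs × InRange q β
  walk-locate s [] {q} s≤q q<s+0 = ⊥-elim (<⇒≱ (subst (q <_) (+-identityʳ ⟪ s ⟫) q<s+0) s≤q)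
  walk-locate {ρ} s (run ℓ c ∷ rs) {q} s≤q q<s+ℓ+T with q <? ⟪ s ⊕ ℓ ⟫
  ... | yes q<s+ℓ = block ρ s (s ⊕ ℓ) c , here refl , s≤q , q<s+ℓ
  ... | no  q≮s+ℓ with walk-locate (s ⊕ ℓ) rs (≮⇒≥ q≮s+ℓ)
                         (subst (q <_) (sym (+-assoc ⟪ s ⟫ ⟪ ℓ ⟫ ⟪ total rs ⟫)) q<s+ℓ+T)
  ...   | β , β∈ , in-range = β , there β∈ , in-range

  walk-beyond : ∀ rs {q} → ⟪ total rs ⟫ ≤ q → walk rs q ≡ excluded
  walk-beyond []             _   = refl
  walk-beyond (run ℓ c ∷ rs) ℓ+T≤q =
    trans (if-<ᵇ-else (m+n≤o⇒m≤o ⟪ ℓ ⟫ ℓ+T≤q)) (walk-beyond rs (+-≤-∸ {⟪ ℓ ⟫} ℓ+T≤q))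

  ∈-blocks⁻ : ∀ {β} → β ∈ blocks → β ∈ blocksFrom (res β) (cst 0) (runs (res β))
  ∈-blocks⁻ β∈ with satisfied (∈-concatMap⁻ (λ ρ → blocksFrom ρ (cst 0) (runs ρ)) {xs = allFin 3} β∈)
  ... | ρ , β∈ρ rewrite blocksFrom-res β∈ρ = β∈ρ

  ∈-blocks⁺ : ∀ {ρ β} → β ∈ blocksFrom ρ (cst 0) (runs ρ) → β ∈ blocks
  ∈-blocks⁺ {ρ} β∈ = ∈-concatMap⁺ (λ ρ → blocksFrom ρ (cst 0) (runs ρ)) (lose (∈-allFin ρ) β∈)

  S-block : ∀ {β q} → β ∈ blocks → InRange q β → S (3 * q + toℕ (res β)) ≡ isMember (cell β)
  S-block {β} {q} β∈ in-range =
    trans (S-canonical q (res β)) (cong isMember (walk-block (∈-blocks⁻ β∈) in-range))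

  disjointSum-sound : ∀ c {β₁ β₂ β₃ q₁ q₂ q₃} → T (disjointSumᵇ c β₁ β₂ β₃) →
    InRange q₁ β₁ → InRange q₂ β₂ → InRange q₃ β₃ → q₃ ≡ q₁ + q₂ + c → ⊥
  disjointSum-sound c {β₁} {β₂} {β₃} {q₁} {q₂} ok (lo₁≤q₁ , q₁<hi₁) (lo₂≤q₂ , q₂<hi₂) (lo₃≤q₃ , q₃<hi₃) refl
    with ∨-split (hi β₃ ≤ᴬ lo β₁ ⊕ lo β₂ ⊕ cst c) ok
  ... | inj₁ hi₃≤ = <⇒≱ q₃<hi₃ (begin
    ⟪ hi β₃ ⟫                      ≤⟨ ≤ᴬ⇒≤ (hi β₃) (lo β₁ ⊕ lo β₂ ⊕ cst c) hi₃≤ ⟩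
    ⟪ lo β₁ ⟫ + ⟪ lo β₂ ⟫ + c      ≤⟨ +-monoˡ-≤ c (+-mono-≤ lo₁≤q₁ lo₂≤q₂) ⟩
    q₁ + q₂ + c                    ∎)
    where open ≤-Reasoning
  ... | inj₂ hi₁₂≤ = <⇒≱ (n<1+n (q₁ + q₂ + c)) (+-cancelʳ-≤ 1 _ _ (begin
    suc (q₁ + q₂ + c) + 1          ≡⟨ regroup q₁ q₂ c ⟩
    suc q₁ + suc q₂ + c            ≤⟨ +-monoˡ-≤ c (+-mono-≤ q₁<hi₁ q₂<hi₂) ⟩
    ⟪ hi β₁ ⟫ + ⟪ hi β₂ ⟫ + c      ≤⟨ ≤ᴬ⇒≤ (hi β₁ ⊕ hi β₂ ⊕ cst c) (lo β₃ ⊕ cst 1) hi₁₂≤ ⟩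
    ⟪ lo β₃ ⟫ + 1                  ≤⟨ +-monoˡ-≤ 1 lo₃≤q₃ ⟩
    q₁ + q₂ + c + 1                ∎))
    where
    open ≤-Reasoning
    regroup : ∀ q₁ q₂ c → suc (q₁ + q₂ + c) + 1 ≡ suc q₁ + suc q₂ + c
    regroup = solve-∀

  sumFree-sound : ∀ {β₁ β₂ β₃ q₁ q₂ q₃} → T (sumFreeᵇ β₁ β₂ β₃) →
    InRange q₁ β₁ → InRange q₂ β₂ → InRange q₃ β₃ →
    3 * q₁ + toℕ (res β₁) + (3 * q₂ + toℕ (res β₂)) ≡ 3 * q₃ + toℕ (res β₃) → ⊥
  sumFree-sound {β₁} {β₂} {β₃} {q₁} {q₂} {q₃} ok in₁ in₂ in₃ sum
    with canonical-injective {q₁ + q₂ + carry β₁ β₂} {q₃} {sumRes β₁ β₂} {res β₃}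
           (trans (+-canonical q₁ q₂ (res β₁) (res β₂)) sum)
  ... | q₃≡ , r≡ρ₃ with ∨-split (not (toℕ (sumRes β₁ β₂) ≡ᵇ toℕ (res β₃))) ok
  ...   | inj₁ r≢ρ₃  = not-≡ᵇ-refl (toℕ (res β₃)) (subst (λ x → T (not (toℕ x ≡ᵇ toℕ (res β₃)))) r≡ρ₃ r≢ρ₃)
  ...   | inj₂ apart = disjointSum-sound (carry β₁ β₂) {β₁} {β₂} {β₃} apart in₁ in₂ in₃ (sym q₃≡)

  reflects-sound : ∀ c {β β′ q} → T (reflectsᵇ c β β′) → InRange q β →
    ∃ λ q′ → InRange q′ β′ × n ∸ (3 * q + toℕ (res β)) ≡ 3 * q′ + toℕ (res β′)
  reflects-sound c {β} {β′} {q} ok (lo≤q , q<hi) =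
    Q ∸ (q + c) , (m+n≤o⇒m≤o∸n ⟪ lo β′ ⟫ lo′+q+c≤Q , ∸-< q+c≤Q Q<hi′+q+c) , complement
    where
    Q = ⟪ quotient ⟫
    D = 3 * q + toℕ (res β)
    ρ+ρ′≡ : toℕ (res β) + toℕ (res β′) ≡ toℕ remainder + 3 * c
    ρ+ρ′≡ = ≡ᵇ⇒≡ _ _ (∧₁ ok)
    below = ∧₁ (∧₂ (toℕ (res β) + toℕ (res β′) ≡ᵇ toℕ remainder + 3 * c) ok)
    above = ∧₂ (lo β′ ⊕ cst c ⊕ hi β ≤ᴬ quotient ⊕ cst 1) (∧₂ (toℕ (res β) + toℕ (res β′) ≡ᵇ toℕ remainder + 3 * c) ok)
    lo′+q+c≤Q : ⟪ lo β′ ⟫ + (q + c) ≤ Q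
    lo′+q+c≤Q = +-cancelʳ-≤ 1 _ _ (begin
      ⟪ lo β′ ⟫ + (q + c) + 1       ≡⟨ regroup ⟪ lo β′ ⟫ q c ⟩
      ⟪ lo β′ ⟫ + c + suc q         ≤⟨ +-monoʳ-≤ (⟪ lo β′ ⟫ + c) q<hi ⟩
      ⟪ lo β′ ⟫ + c + ⟪ hi β ⟫      ≤⟨ ≤ᴬ⇒≤ (lo β′ ⊕ cst c ⊕ hi β) (quotient ⊕ cst 1) below ⟩
      Q + 1                         ∎)
      where
      open ≤-Reasoning
      regroup : ∀ l q c → l + (q + c) + 1 ≡ l + c + suc q
      regroup = solve-∀
    Q<hi′+q+c : Q < ⟪ hi β′ ⟫ + (q + c)
    Q<hi′+q+c = begin
      suc Q                         ≡⟨ +-comm 1 Q ⟩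
      Q + 1                         ≤⟨ ≤ᴬ⇒≤ (quotient ⊕ cst 1) (hi β′ ⊕ lo β ⊕ cst c) above ⟩
      ⟪ hi β′ ⟫ + ⟪ lo β ⟫ + c      ≤⟨ +-monoˡ-≤ c (+-monoʳ-≤ ⟪ hi β′ ⟫ lo≤q) ⟩
      ⟪ hi β′ ⟫ + q + c             ≡⟨ +-assoc ⟪ hi β′ ⟫ q c ⟩
      ⟪ hi β′ ⟫ + (q + c)           ∎
      where open ≤-Reasoning
    q+c≤Q : q + c ≤ Q
    q+c≤Q = m+n≤o⇒n≤o ⟪ lo β′ ⟫ lo′+q+c≤Q
    complement : n ∸ D ≡ 3 * (Q ∸ (q + c)) + toℕ (res β′)
    complement = begin
      n ∸ D                                              ≡⟨ cong (_∸ D) n≡ ⟩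
      3 * Q + toℕ remainder ∸ D                          ≡⟨ cong (_∸ D) (sym (recombine {q} {c} (toℕ (res β)) (toℕ (res β′)) (toℕ remainder) ρ+ρ′≡ q+c≤Q)) ⟩
      D + (3 * (Q ∸ (q + c)) + toℕ (res β′)) ∸ D         ≡⟨ m+n∸m≡n D _ ⟩
      3 * (Q ∸ (q + c)) + toℕ (res β′)                   ∎
      where open ≡-Reasoning

  reflects-either : ∀ {β β′ q} → T (reflectsᵇ 0 β β′ ∨ reflectsᵇ 1 β β′) → InRange q β →
    ∃ λ q′ → InRange q′ β′ × n ∸ (3 * q + toℕ (res β)) ≡ 3 * q′ + toℕ (res β′)
  reflects-either {β} {β′} ok in-range with ∨-split (reflectsᵇ 0 β β′) ok
  ... | inj₁ r₀ = reflects-sound 0 {β} {β′} r₀ in-range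
  ... | inj₂ r₁ = reflects-sound 1 {β} {β′} r₁ in-range

  contains-sound : ∀ w {β} → T (containsᵇ w β) → InRange ⟪ Summand.quot w ⟫ β × Summand.rem w ≡ res β
  contains-sound (summand qa ρa _) {β} ok =
    (≤ᴬ⇒≤ (lo β) qa (∧₁ rest) , subst (_≤ ⟪ hi β ⟫) (+-comm ⟪ qa ⟫ 1) (≤ᴬ⇒≤ (qa ⊕ cst 1) (hi β) (∧₂ (lo β ≤ᴬ qa) rest))) ,
    toℕ-injective (≡ᵇ⇒≡ (toℕ ρa) (toℕ (res β)) (∧₁ ok))
    where rest = ∧₂ (toℕ ρa ≡ᵇ toℕ (res β)) ok

  target-sound : ∀ w {β q} → InRange q β →
    ∃ λ q′ → InRange q′ (target w β) × 3 * q′ + toℕ (res (target w β)) ≡ 3 * q + toℕ (res β) + (if Summand.wraps w then n else 0)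
  target-sound (summand _ _ false) {β} {q} in-range = q , in-range , sym (+-identityʳ _)
  target-sound (summand _ _ true) {block ρ l h c} {q} (l≤q , q<h) =
    q + Q + k , (+-monoˡ-≤ k (+-monoˡ-≤ Q l≤q) , +-monoˡ-< k (+-monoˡ-< Q q<h)) , (begin
      3 * (q + Q + k) + toℕ r                ≡⟨ +-canonical q Q ρ remainder ⟩
      3 * q + toℕ ρ + (3 * Q + toℕ remainder) ≡⟨ cong (3 * q + toℕ ρ +_) (sym n≡) ⟩
      3 * q + toℕ ρ + n                       ∎)
    where
    open ≡-Reasoning
    Q = ⟪ quotient ⟫
    k = proj₁ (quotRem₃ (toℕ ρ + toℕ remainder))
    r = proj₂ (quotRem₃ (toℕ ρ + toℕ remainder))

  complements-sound : ∀ c w {τ β q′} → T (complementsᵇ c w τ β) → InRange q′ τ →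
    ∃ λ qb → InRange qb β × 3 * ⟪ Summand.quot w ⟫ + toℕ (Summand.rem w) + (3 * qb + toℕ (res β)) ≡ 3 * q′ + toℕ (res τ)
  complements-sound c (summand qa ρa _) {τ} {β} {q′} ok (loτ≤q′ , q′<hiτ) =
    q′ ∸ (a + c) , (m+n≤o⇒m≤o∸n ⟪ lo β ⟫ lo+a+c≤q′ , ∸-< a+c≤q′ q′<hi+a+c) ,
    recombine {a} {c} (toℕ ρa) (toℕ (res β)) (toℕ (res τ)) (≡ᵇ⇒≡ _ _ (∧₁ ok)) a+c≤q′
    where
    a = ⟪ qa ⟫
    bounds = ∧₂ (toℕ ρa + toℕ (res β) ≡ᵇ toℕ (res τ) + 3 * c) ok
    lo+a+c≤q′ : ⟪ lo β ⟫ + (a + c) ≤ q′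
    lo+a+c≤q′ = ≤-trans (≤-reflexive (sym (+-assoc ⟪ lo β ⟫ a c)))
                        (≤-trans (≤ᴬ⇒≤ (lo β ⊕ qa ⊕ cst c) (lo τ) (∧₁ bounds)) loτ≤q′)
    a+c≤q′ : a + c ≤ q′
    a+c≤q′ = m+n≤o⇒n≤o ⟪ lo β ⟫ lo+a+c≤q′
    q′<hi+a+c : q′ < ⟪ hi β ⟫ + (a + c)
    q′<hi+a+c = <-≤-trans q′<hiτ (≤-trans (≤ᴬ⇒≤ (hi τ) (hi β ⊕ qa ⊕ cst c) (∧₂ (lo β ⊕ qa ⊕ cst c ≤ᴬ lo τ) bounds))
                                          (≤-reflexive (+-assoc ⟪ hi β ⟫ a c)))

  complements-either : ∀ {w τ β q′} → T (complementsᵇ 0 w τ β ∨ complementsᵇ 1 w τ β) → InRange q′ τ →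
    ∃ λ qb → InRange qb β × 3 * ⟪ Summand.quot w ⟫ + toℕ (Summand.rem w) + (3 * qb + toℕ (res β)) ≡ 3 * q′ + toℕ (res τ)
  complements-either {w} {τ} {β} ok in-range with ∨-split (complementsᵇ 0 w τ β) ok
  ... | inj₁ c₀ = complements-sound 0 w {τ} {β} c₀ in-range
  ... | inj₂ c₁ = complements-sound 1 w {τ} {β} c₁ in-range

  wrap-cases : ∀ b {x D} → x ≡ D + (if b then n else 0) → x ≡ D ⊎ x ≡ D + n
  wrap-cases true  eq = inj₂ eq
  wrap-cases false eq = inj₁ (trans eq (+-identityʳ _))

  excluded-sound : ∀ {ρ l h q} → T (justifiedᵇ (block ρ l h excluded)) → InRange q (block ρ l h excluded) →
                   3 * q + toℕ ρ ≡ 0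
  excluded-sound {ρ} {l} {h} {q} ok (_ , q<h)
    with n<1⇒n≡0 (<-≤-trans q<h (≤ᴬ⇒≤ h (cst 1) (∧₂ (toℕ ρ ≡ᵇ 0) ok)))
  ... | refl = ≡ᵇ⇒≡ (toℕ ρ) 0 (∧₁ ok)

  count-walk : ∀ rs e → count (isMember ∘ walk rs) (⟪ total rs ⟫ + e) ≡ ⟪ memberLength rs ⟫
  count-walk []             e = count-const false e
  count-walk (run ℓ c ∷ rs) e = begin
    count f (⟪ ℓ ⟫ + ⟪ total rs ⟫ + e)                              ≡⟨ cong (count f) (+-assoc ⟪ ℓ ⟫ _ e) ⟩
    count f (⟪ ℓ ⟫ + (⟪ total rs ⟫ + e))                            ≡⟨ count-+ f ⟪ ℓ ⟫ _ ⟩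
    count f ⟪ ℓ ⟫ + count (λ i → f (⟪ ℓ ⟫ + i)) (⟪ total rs ⟫ + e)  ≡⟨ cong₂ _+_ (count-cong _ inside) (count-cong _ after) ⟩
    count (λ _ → isMember c) ⟪ ℓ ⟫ + count (isMember ∘ walk rs) (⟪ total rs ⟫ + e)
                                                                    ≡⟨ cong₂ _+_ (count-const (isMember c) ⟪ ℓ ⟫) (count-walk rs e) ⟩
    indicator (isMember c) * ⟪ ℓ ⟫ + ⟪ memberLength rs ⟫            ≡⟨ cong (_+ ⟪ memberLength rs ⟫) (run-size (isMember c)) ⟩
    ⟪ memberLength (run ℓ c ∷ rs) ⟫                                 ∎
    where
    open ≡-Reasoning
    f = isMember ∘ walk (run ℓ c ∷ rs)
    inside : ∀ i → i < ⟪ ℓ ⟫ → f i ≡ isMember c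
    inside i i<ℓ = cong isMember (if-<ᵇ-then i<ℓ)
    after : ∀ i → i < ⟪ total rs ⟫ + e → f (⟪ ℓ ⟫ + i) ≡ isMember (walk rs i)
    after i _ = cong isMember (trans (if-<ᵇ-else (m≤m+n ⟪ ℓ ⟫ i)) (cong (walk rs) (m+n∸m≡n ⟪ ℓ ⟫ i)))
    run-size : ∀ b → indicator b * ⟪ ℓ ⟫ ≡ ⟪ if b then ℓ else cst 0 ⟫
    run-size true  = +-identityʳ ⟪ ℓ ⟫
    run-size false = refl

module Valid (L : Layout) {d : Affine} (ok : T (Checks.valid L d)) (t : ℕ) where

  open Layout L
  open Checks L
  open Semantics L t
  open Block

  private
    rest₁ = ∧₂ (all coveredᵇ (allFin 3)) ok
    rest₂ = ∧₂ (all avoidsZeroᵇ members) rest₁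
    rest₃ = ∧₂ (all (λ β₁ → all (λ β₂ → all (sumFreeᵇ β₁ β₂) members) members) members) rest₂
    rest₄ = ∧₂ (all (λ β → any (λ β′ → reflectsᵇ 0 β β′ ∨ reflectsᵇ 1 β β′) members) members) rest₃
    rest₅ = ∧₂ (all justifiedᵇ blocks) rest₄

  covered : ∀ ρ → T (coveredᵇ ρ)
  covered ρ = All.lookup (all⁺ coveredᵇ (allFin 3) (∧₁ ok)) (∈-allFin ρ)

  avoids-zero : ∀ {β} → β ∈ members → T (avoidsZeroᵇ β)
  avoids-zero = All.lookup (all⁺ avoidsZeroᵇ members (∧₁ rest₁))

  sum-free : ∀ {β₁ β₂ β₃} → β₁ ∈ members → β₂ ∈ members → β₃ ∈ members → T (sumFreeᵇ β₁ β₂ β₃)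
  sum-free β₁∈ β₂∈ = All.lookup (all⁺ _ members (All.lookup (all⁺ _ members (All.lookup (all⁺ _ members (∧₁ rest₂)) β₁∈)) β₂∈))

  reflected : ∀ {β} → β ∈ members → T (any (λ β′ → reflectsᵇ 0 β β′ ∨ reflectsᵇ 1 β β′) members)
  reflected = All.lookup (all⁺ _ members (∧₁ rest₃))

  justified : ∀ {β} → β ∈ blocks → T (justifiedᵇ β)
  justified = All.lookup (all⁺ justifiedᵇ blocks (∧₁ rest₄))

  size≡d : ⟪ size ⟫ ≡ ⟪ d ⟫
  size≡d = ≤-antisym (≤ᴬ⇒≤ size d (∧₁ rest₅)) (≤ᴬ⇒≤ d size (∧₂ (size ≤ᴬ d) rest₅))

  boundary : Fin 3 → ℕ
  boundary ρ = 3 * ⟪ total (runs ρ) ⟫ + toℕ ρ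

  n≤boundary : ∀ ρ → n ≤ boundary ρ
  n≤boundary ρ = subst (n ≤_) (cong (_+ toℕ ρ) (thrice ⟪ total (runs ρ) ⟫)) (≤ᴬ⇒≤ order (tripled ρ) (∧₁ (covered ρ)))

  boundary≤n+2 : ∀ ρ → boundary ρ ≤ n + 2
  boundary≤n+2 ρ = subst (_≤ n + 2) (cong (_+ toℕ ρ) (thrice ⟪ total (runs ρ) ⟫))
                   (≤ᴬ⇒≤ (tripled ρ) (order ⊕ cst 2) (∧₂ (order ≤ᴬ tripled ρ) (covered ρ)))

  S-< : ∀ {D} → S D ≡ true → D < n
  S-< {D} SD with quotRem₃ D | quotRem₃-correct D
  ... | q , ρ | refl with ⟪ total (runs ρ) ⟫ ≤? q
  ...   | yes T≤q = ⊥-elim (false≢true (trans (sym (cong isMember (walk-beyond (runs ρ) T≤q))) SD))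
    where
    false≢true : false ≢ true
    false≢true ()
  ...   | no  T≰q = +-cancelʳ-≤ 2 _ _ (≤-trans three-more (boundary≤n+2 ρ))
    where
    three-more : suc (3 * q + toℕ ρ) + 2 ≤ boundary ρ
    three-more = subst (_≤ boundary ρ) (shuffle q (toℕ ρ)) (+-monoˡ-≤ (toℕ ρ) (*-monoʳ-≤ 3 (≰⇒> T≰q)))
      where
      shuffle : ∀ q r → 3 * suc q + r ≡ suc (3 * q + r) + 2
      shuffle = solve-∀

  S-locate : ∀ {D} → D < n → Located D blocks
  S-locate {D} D<n with quotRem₃ D | quotRem₃-correct D
  ... | q , ρ | refl with walk-locate {ρ} (cst 0) (runs ρ) z≤n q<T
    where
    q<T : q < ⟪ total (runs ρ) ⟫
    q<T = *-cancelˡ-< 3 _ _ (+-cancelʳ-< (toℕ ρ) _ _ (<-≤-trans D<n (n≤boundary ρ)))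
  ... | β , β∈ , in-range rewrite sym (blocksFrom-res β∈) = located (∈-blocks⁺ β∈) refl in-range

  S-member : ∀ {D} → S D ≡ true → Located D members
  S-member {D} SD with S-locate (S-< {D} SD)
  ... | located β∈ refl in-range =
    located (∈-filter⁺ (T? ∘ isMember ∘ cell) β∈ (Equivalence.from T-≡ (trans (sym (S-block β∈ in-range)) SD)))
            refl in-range

  S-nonmember : ∀ {D} → D < n → S D ≡ false → Σ (Located D blocks) λ l → isMember (cell (Located.place l)) ≡ false
  S-nonmember {D} D<n SD with S-locate D<n
  ... | l@(located β∈ refl in-range) = l , trans (sym (S-block β∈ in-range)) SD

  member-S : ∀ {β q} → β ∈ members → InRange q β → S (3 * q + toℕ (res β)) ≡ true
  member-S β∈ in-range with ∈-filter⁻ (T? ∘ isMember ∘ cell) β∈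
  ... | β∈blocks , isMem = trans (S-block β∈blocks in-range) (Equivalence.to T-≡ isMem)

  S-0 : S 0 ≡ false
  S-0 with S 0 in S0
  ... | false = refl
  ... | true with S-member {0} S0
  ...   | located {q} {β} β∈ 0≡ (lo≤q , _) with canonical-injective {0} {q} {0F} {res β} 0≡
  ...     | refl , refl = ⊥-elim (<⇒≱ z<s (≤-trans (≤ᴬ⇒≤ (cst 1) (lo β) (avoids-zero β∈)) lo≤q))

  S-reflect : ∀ {D} → S D ≡ true → S (n ∸ D) ≡ true
  S-reflect {D} SD with S-member {D} SD
  ... | located {q} {β} β∈ refl in-range
    with find (any⁻ _ members (reflected β∈))
  ...   | β′ , β′∈ , reflected with reflects-either {β} {β′} reflected in-range
  ...     | q′ , in-range′ , eq = trans (cong S eq) (member-S β′∈ in-range′)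

  S-sum-free : ∀ {a b} → S a ≡ true → S b ≡ true → S (a + b) ≡ true → ⊥
  S-sum-free {a} {b} Sa Sb Sab with S-member {a} Sa | S-member {b} Sb | S-member {a + b} Sab
  ... | located {place = β₁} β₁∈ refl in₁ | located {place = β₂} β₂∈ refl in₂ | located {place = β₃} β₃∈ sum in₃ =
    sumFree-sound {β₁} {β₂} {β₃} (sum-free β₁∈ β₂∈ β₃∈) in₁ in₂ in₃ sum

  S-complete : ∀ {D} → 0 < D → D < n → S D ≡ false →
               ∃ λ a → ∃ λ b → S a ≡ true × S b ≡ true × (a + b ≡ D ⊎ a + b ≡ D + n)
  S-complete {D} D>0 D<n SD with S-nonmember {D} D<n SD
  ... | located {place = block _ _ _ member} _ _ _ , ()
  ... | located {place = block ρ l h excluded} β∈ refl in-range , _ =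
    ⊥-elim (<⇒≢ D>0 (sym (excluded-sound {ρ} {l} {h} (justified β∈) in-range)))
  ... | located {place = β@(block _ _ _ (nonmember w))} β∈ refl in-range , _
    with find (any⁻ _ members (∧₁ (justified β∈))) | target-sound w {β} in-range
  ...   | βa , βa∈ , contains | q′ , in-target , target≡
    with contains-sound w {βa} contains
       | find (any⁻ _ members (∧₂ (any (containsᵇ w) members) (justified β∈)))
  ...     | in-a , refl | βb , βb∈ , complements
    with complements-either {w} {target w β} {βb} complements in-target
  ...       | qb , in-b , a+b≡ =
    3 * ⟪ Summand.quot w ⟫ + toℕ (res βa) , 3 * qb + toℕ (res βb) ,
    member-S βa∈ in-a , member-S βb∈ in-b , wrap-cases (Summand.wraps w) (trans a+b≡ target≡)

  total≤quotient+1 : ∀ ρ → ⟪ total (runs ρ) ⟫ ≤ ⟪ quotient ⟫ + 1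
  total≤quotient+1 ρ = s≤s⁻¹ (*-cancelˡ-< 3 _ _ (begin-strict
    3 * ⟪ total (runs ρ) ⟫                    ≤⟨ m≤m+n _ (toℕ ρ) ⟩
    boundary ρ                                  ≤⟨ boundary≤n+2 ρ ⟩
    n + 2                                     ≡⟨ cong (_+ 2) n≡ ⟩
    3 * Q + toℕ remainder + 2                 <⟨ +-monoˡ-< 2 (+-monoʳ-< (3 * Q) (toℕ<n remainder)) ⟩
    3 * Q + 3 + 2                             <⟨ ≤-reflexive (sym (regroup Q)) ⟩
    3 * suc (Q + 1)                           ∎))
    where
    open ≤-Reasoning
    Q = ⟪ quotient ⟫
    regroup : ∀ Q → 3 * suc (Q + 1) ≡ suc (3 * Q + 3 + 2)
    regroup = solve-∀

  residue-count : ∀ ρ → count (λ q → S (3 * q + toℕ ρ)) (⟪ quotient ⟫ + 1) ≡ ⟪ memberLength (runs ρ) ⟫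
  residue-count ρ = begin
    count (λ q → S (3 * q + toℕ ρ)) M                          ≡⟨ count-cong M (λ q _ → S-canonical q ρ) ⟩
    count (isMember ∘ walk (runs ρ)) M                         ≡⟨ cong (count _) (sym (m+[n∸m]≡n (total≤quotient+1 ρ))) ⟩
    count (isMember ∘ walk (runs ρ)) (⟪ total (runs ρ) ⟫ + _)  ≡⟨ count-walk (runs ρ) _ ⟩
    ⟪ memberLength (runs ρ) ⟫                                  ∎
    where
    open ≡-Reasoning
    M = ⟪ quotient ⟫ + 1

  S-count : count S n ≡ ⟪ d ⟫
  S-count = begin
    count S n                                                   ≡⟨ sym (+-identityʳ _) ⟩
    count S n + 0                                               ≡⟨ cong (count S n +_) (sym (count-false _ beyond)) ⟩
    count S n + count (λ i → S (n + i)) (3 * M ∸ n)             ≡⟨ sym (count-+ S n _) ⟩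
    count S (n + (3 * M ∸ n))                                   ≡⟨ cong (count S) (m+[n∸m]≡n n≤3M) ⟩
    count S (3 * M)                                             ≡⟨ count-residues S M ⟩
    count (λ q → S (3 * q + 0)) M + count (λ q → S (3 * q + 1)) M + count (λ q → S (3 * q + 2)) M
      ≡⟨ cong₂ _+_ (cong₂ _+_ (residue-count 0F) (residue-count 1F)) (residue-count 2F) ⟩
    ⟪ size ⟫                                                    ≡⟨ size≡d ⟩
    ⟪ d ⟫                                                       ∎
    where
    open ≡-Reasoning
    M = ⟪ quotient ⟫ + 1
    n≤3M : n ≤ 3 * M
    n≤3M = ≤-trans (≤-reflexive n≡) (≤-trans (+-monoʳ-≤ (3 * ⟪ quotient ⟫) (<⇒≤ (toℕ<n remainder)))
                                              (≤-reflexive (sym (*-distribˡ-+ 3 ⟪ quotient ⟫ 1))))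
    beyond : ∀ i → i < 3 * M ∸ n → S (n + i) ≡ false
    beyond i _ with S (n + i) in Sn+i
    ... | false = refl
    ... | true  = ⊥-elim (m+n≮m n i (S-< Sn+i))

  completeSumFreeSet : CompleteSumFreeSet n ⟪ d ⟫
  completeSumFreeSet = record
    { S          = S
    ; S-0        = S-0
    ; S-<        = λ {D} → S-< {D}
    ; S-reflect  = λ {D} → S-reflect {D}
    ; S-sum-free = λ {a} {b} → S-sum-free {a} {b}
    ; S-complete = λ {D} → S-complete {D}
    ; S-count    = S-count
    }

-- Finite graphs decided by evaluation

module _ {n : ℕ} where

  ∀ᵇ : (Fin n → Bool) → Bool
  ∀ᵇ p = all p (allFin n)

  ∃ᵇ : (Fin n → Bool) → Bool
  ∃ᵇ p = any p (allFin n)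

  ∀ᵇ-sound : ∀ p → T (∀ᵇ p) → ∀ i → T (p i)
  ∀ᵇ-sound p ok i = All.lookup (all⁺ p (allFin n) ok) (∈-allFin i)

  ∃ᵇ-sound : ∀ p → T (∃ᵇ p) → ∃ λ i → T (p i)
  ∃ᵇ-sound p ok = satisfied (any⁻ p (allFin n) ok)

  fromAdjacency : (a : Fin n → Fin n → Bool) →
                  T (∀ᵇ λ u → ∀ᵇ λ v → not (a u v xor a v u)) → T (∀ᵇ λ v → not (a v v)) → Graph n
  fromAdjacency a sym loop = record
    { adj       = a
    ; symmetric = λ u v → xor-sound (∀ᵇ-sound _ (∀ᵇ-sound _ sym u) v)
    ; loopless  = λ v → not-sound (∀ᵇ-sound _ loop v)
    }
    where
    xor-sound : ∀ {x y} → T (not (x xor y)) → x ≡ y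
    xor-sound {true}  {true}  _ = refl
    xor-sound {false} {false} _ = refl
    not-sound : ∀ {x} → T (not x) → x ≡ false
    not-sound {false} _ = refl

  module _ (G : Graph n) where

    triangleFreeᵇ : Bool
    triangleFreeᵇ = ∀ᵇ λ u → ∀ᵇ λ v → ∀ᵇ λ w → not (adj G u v ∧ adj G v w ∧ adj G u w)

    saturatedᵇ : Bool
    saturatedᵇ = ∀ᵇ λ u → ∀ᵇ λ v → does (u ≟ᶠ v) ∨ adj G u v ∨ ∃ᵇ (λ w → adj G u w ∧ adj G w v)

    regularᵇ : ℕ → Bool
    regularᵇ d = ∀ᵇ λ v → degree G v ≡ᵇ d

    K3Saturated-by-computation : T triangleFreeᵇ → T saturatedᵇ → K3Saturated G
    K3Saturated-by-computation tf sat = triangle-free , saturated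
      where
      triangle-free : TriangleFree G
      triangle-free u v w uv vw uw with ∀ᵇ-sound _ (∀ᵇ-sound _ (∀ᵇ-sound _ tf u) v) w
      ... | ok rewrite uv | vw | uw = ok
      saturated : ∀ u v → u ≢ v → ¬ Adj G u v → ∃ λ w → Adj G u w × Adj G w v
      saturated u v u≢v ¬uv with u ≟ᶠ v | adj G u v in uv | ∀ᵇ-sound _ (∀ᵇ-sound _ sat u) v
      ... | yes u≡v | _     | _  = ⊥-elim (u≢v u≡v)
      ... | no _    | true  | _  = ⊥-elim (¬uv refl)
      ... | no _    | false | ok with ∃ᵇ-sound _ ok
      ...   | w , uwv = w , Equivalence.to T-≡ (∧₁ uwv) , Equivalence.to T-≡ (∧₂ (adj G u w) uwv)

    regular-by-computation : ∀ d → T (regularᵇ d) → Regular G d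
    regular-by-computation d ok v = ≡ᵇ⇒≡ _ d (∀ᵇ-sound _ ok v)

-- Realized as the Kneser graph K(5,2).
petersen : Graph 10
petersen = fromAdjacency disjoint _ _
  where
  pairs : List (Fin 5 × Fin 5)
  pairs = (# 0 , # 1) ∷ (# 0 , # 2) ∷ (# 0 , # 3) ∷ (# 0 , # 4) ∷ (# 1 , # 2) ∷
          (# 1 , # 3) ∷ (# 1 , # 4) ∷ (# 2 , # 3) ∷ (# 2 , # 4) ∷ (# 3 , # 4) ∷ []
  meets : Fin 5 × Fin 5 → Fin 5 × Fin 5 → Bool
  meets (a , b) (c , d) = does (a ≟ᶠ c) ∨ does (a ≟ᶠ d) ∨ does (b ≟ᶠ c) ∨ does (b ≟ᶠ d)
  disjoint : Fin 10 → Fin 10 → Bool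
  disjoint u v = not (meets (lookup pairs u) (lookup pairs v))

petersen-K3Saturated : K3Saturated petersen
petersen-K3Saturated = K3Saturated-by-computation petersen _ _

petersen-regular : Regular petersen 3
petersen-regular = regular-by-computation petersen 3 _

-- The three families

Realization : ℕ → ℕ → Set
Realization n d = Σ (Graph n) λ G → K3Saturated G × Regular G d

realization-cast : ∀ {n n′ d d′} → n ≡ n′ → d ≡ d′ → Realization n d → Realization n′ d′
realization-cast refl refl R = R

circulant-realization : ∀ {n d} → CompleteSumFreeSet n d → Realization n d
circulant-realization C = circulant C , circulant-K3Saturated C , circulant-regular C

layout-realization : ∀ L d → T (Checks.valid L d) → ∀ t → Realization (⟦ Layout.order L ⟧ t) (⟦ d ⟧ t)
layout-realization L d ok t = circulant-realization (Valid.completeSumFreeSet L {d} ok t)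

-- n = 3t + 2 and S = {D ≡ 1 (mod 3)}.
layout₂ : Layout
layout₂ = record { quotient = aff 0 1 ; remainder = 2F ; runs = runs }
  where
  runs : Fin 3 → List Run
  runs 0F = run (cst 1) excluded
          ∷ run (aff 0 1) (nonmember (summand (aff 0 1) 1F true))
          ∷ []
  runs 1F = run (aff 1 1) member
          ∷ []
  runs 2F = run (aff 0 1) (nonmember (summand (cst 0) 1F false))
          ∷ []

-- n = 3k + 1 with k = 4 + t, and S = {1, 3k} ∪ {D ≡ 2 (mod 3) : 5 ≤ D ≤ 3k − 4}.
layout₁ : Layout
layout₁ = record { quotient = k ; remainder = 1F ; runs = runs }
  where
  k = aff 4 1
  runs : Fin 3 → List Run
  runs 0F = run (cst 1) excluded
          ∷ run (cst 1) (nonmember (summand (cst 2) 2F true))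
          ∷ run (aff 2 1) (nonmember (summand (cst 0) 1F false))
          ∷ run (cst 1) member
          ∷ []
  runs 1F = run (cst 1) member
          ∷ run (cst 2) (nonmember (summand k 0F true))
          ∷ run (aff 1 1) (nonmember (summand (cst 1) 2F false))
          ∷ []
  runs 2F = run (cst 1) (nonmember (summand (cst 0) 1F false))
          ∷ run (aff 2 1) member
          ∷ run (cst 1) (nonmember (summand k 0F true))
          ∷ []

-- n = 3k with k = 3m + i and m = m₀ + t, and
-- S = {1, n − 1} ∪ {D ≡ 2 : 5 ≤ D < 3m} ∪ {D ≡ 0 : 3m < D < n − 3m} ∪ {D ≡ 1 : n − 3m < D < n − 4}.
layout₀ : ℕ → ℕ → Layout
layout₀ m₀ i = record { quotient = k ; remainder = 0F ; runs = runs }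
  where
  k   = aff (3 * m₀ + i) 3
  k-1 = aff (3 * m₀ + i ∸ 1) 3
  runs : Fin 3 → List Run
  runs 0F = run (cst 1) excluded
          ∷ run (cst 1) (nonmember (summand (aff (2 * m₀ + i ∸ 1) 2) 0F true))
          ∷ run (aff (m₀ ∸ 1) 1) (nonmember (summand (cst 0) 1F false))
          ∷ run (aff (m₀ + i ∸ 1) 1) member
          ∷ run (aff (m₀ ∸ 1) 1) (nonmember (summand k-1 2F true))
          ∷ run (cst 1) (nonmember (summand (aff (m₀ + 1) 1) 0F false))
          ∷ []
  runs 1F = run (cst 1) member
          ∷ run (cst 1) (nonmember (summand k-1 2F true))
          ∷ run (cst 1) (nonmember (summand (aff (m₀ + 2) 1) 0F true))
          ∷ run (aff (m₀ ∸ 1) 1) (nonmember (summand (cst 1) 2F false))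
          ∷ run (aff (m₀ + i ∸ 2) 1) (nonmember (summand (cst 0) 1F false))
          ∷ run (aff (m₀ ∸ 1) 1) member
          ∷ run (cst 1) (nonmember (summand k-1 2F true))
          ∷ []
  runs 2F = run (cst 1) (nonmember (summand (cst 0) 1F false))
          ∷ run (aff (m₀ ∸ 1) 1) member
          ∷ run (cst 2) (nonmember (summand k-1 2F true))
          ∷ run (aff (m₀ + i ∸ 1) 1) (nonmember (summand (cst 1) 2F false))
          ∷ run (aff (m₀ ∸ 2) 1) (nonmember (summand (cst 0) 1F false))
          ∷ run (cst 1) member
          ∷ []

realization-3k+2 : ∀ k → Realization (3 * k + 2) (k + 1)
realization-3k+2 k = realization-cast (order≡ k) (degree≡ k) (layout-realization layout₂ (aff 1 1) _ k)
  where
  order≡ : ∀ k → 1 * k + 1 * k + 1 * k + 2 ≡ 3 * k + 2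
  order≡ = solve-∀
  degree≡ : ∀ k → 1 + 1 * k ≡ k + 1
  degree≡ = solve-∀

realization-3[4+j]+1 : ∀ j → Realization (3 * (4 + j) + 1) (4 + j)
realization-3[4+j]+1 j = realization-cast (order≡ j) (degree≡ j) (layout-realization layout₁ (aff 4 1) _ j)
  where
  order≡ : ∀ j → 4 + 1 * j + (4 + 1 * j) + (4 + 1 * j) + 1 ≡ 3 * (4 + j) + 1
  order≡ = solve-∀
  degree≡ : ∀ j → 4 + 1 * j ≡ 4 + j
  degree≡ = solve-∀

realization-3[7+j] : ∀ j → Realization (3 * (7 + j) + 0) (7 + j + 0 ∸ 1)
realization-3[7+j] j with quotRem₃ j | quotRem₃-correct j
... | s , 0F | refl =
  realization-cast (order≡ s) (degree≡ s) (layout-realization (layout₀ 2 1) (aff 6 3) _ s)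
  where
  order≡ : ∀ s → 7 + 3 * s + (7 + 3 * s) + (7 + 3 * s) + 0 ≡ 3 * (7 + (3 * s + 0)) + 0
  order≡ = solve-∀
  degree≡ : ∀ s → 6 + 3 * s ≡ 6 + (3 * s + 0) + 0
  degree≡ = solve-∀
... | s , 1F | refl =
  realization-cast (order≡ s) (degree≡ s) (layout-realization (layout₀ 2 2) (aff 7 3) _ s)
  where
  order≡ : ∀ s → 8 + 3 * s + (8 + 3 * s) + (8 + 3 * s) + 0 ≡ 3 * (7 + (3 * s + 1)) + 0
  order≡ = solve-∀
  degree≡ : ∀ s → 7 + 3 * s ≡ 6 + (3 * s + 1) + 0
  degree≡ = solve-∀
... | s , 2F | refl =
  realization-cast (order≡ s) (degree≡ s) (layout-realization (layout₀ 3 0) (aff 8 3) _ s)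
  where
  order≡ : ∀ s → 9 + 3 * s + (9 + 3 * s) + (9 + 3 * s) + 0 ≡ 3 * (7 + (3 * s + 2)) + 0
  order≡ = solve-∀
  degree≡ : ∀ s → 8 + 3 * s ≡ 6 + (3 * s + 2) + 0
  degree≡ = solve-∀

admissibleᵇ : ℕ → Bool
admissibleᵇ n = (20 ≤ᵇ n) ∨ any (n ≡ᵇ_) (5 ∷ 8 ∷ 10 ∷ 11 ∷ 13 ∷ 14 ∷ 16 ∷ 17 ∷ [])

admissible-T : ∀ {n} → (20 ≤ n ⊎ (n ≡ 5 ⊎ n ≡ 8 ⊎ n ≡ 10 ⊎ n ≡ 11 ⊎ n ≡ 13 ⊎ n ≡ 14 ⊎ n ≡ 16 ⊎ n ≡ 17)) →
               T (admissibleᵇ n)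
admissible-T {n} (inj₁ 20≤n) with 20 ≤ᵇ n | ≤⇒≤ᵇ 20≤n
... | true | _ = _
admissible-T (inj₂ (inj₁ refl))                                             = _
admissible-T (inj₂ (inj₂ (inj₁ refl)))                                      = _
admissible-T (inj₂ (inj₂ (inj₂ (inj₁ refl))))                               = _
admissible-T (inj₂ (inj₂ (inj₂ (inj₂ (inj₁ refl)))))                        = _
admissible-T (inj₂ (inj₂ (inj₂ (inj₂ (inj₂ (inj₁ refl))))))                 = _
admissible-T (inj₂ (inj₂ (inj₂ (inj₂ (inj₂ (inj₂ (inj₁ refl)))))))          = _
admissible-T (inj₂ (inj₂ (inj₂ (inj₂ (inj₂ (inj₂ (inj₂ (inj₁ refl))))))))   = _
admissible-T (inj₂ (inj₂ (inj₂ (inj₂ (inj₂ (inj₂ (inj₂ (inj₂ refl))))))))   = _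

realization-3k : ∀ k → T (admissibleᵇ (3 * k + 0)) → Realization (3 * k + 0) (k + 0 ∸ 1)
realization-3k 0 ()
realization-3k 1 ()
realization-3k 2 ()
realization-3k 3 ()
realization-3k 4 ()
realization-3k 5 ()
realization-3k 6 ()
realization-3k (suc (suc (suc (suc (suc (suc (suc j))))))) _ = realization-3[7+j] j

realization-3k+1 : ∀ k → T (admissibleᵇ (3 * k + 1)) → Realization (3 * k + 1) (k + 1 ∸ 1)
realization-3k+1 0 ()
realization-3k+1 1 ()
realization-3k+1 2 ()
realization-3k+1 3 _ = petersen , petersen-K3Saturated , petersen-regular
realization-3k+1 (suc (suc (suc (suc j)))) _ =
  realization-cast refl (sym (m+n∸n≡m (4 + j) 1)) (realization-3[4+j]+1 j)

theorem3p2 : (n k r : ℕ) → (20 ≤ n ⊎ (n ≡ 5 ⊎ n ≡ 8 ⊎ n ≡ 10 ⊎ n ≡ 11 ⊎ n ≡ 13 ⊎ n ≡ 14 ⊎ n ≡ 16 ⊎ n ≡ 17)) →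
    r < 3 → n ≡ 3 * k + r →
    Σ (Graph n) λ G → K3Saturated G × Regular G (k + r ∸ 1)
theorem3p2 _ k 0 admissible _ refl = realization-3k k (admissible-T admissible)
theorem3p2 _ k 1 admissible _ refl = realization-3k+1 k (admissible-T admissible)
theorem3p2 _ k 2 _          _ refl = realization-cast refl (sym (+-∸-assoc k (s≤s z≤n))) (realization-3k+2 k)
theorem3p2 _ _ (suc (suc (suc _))) _ (s≤s (s≤s (s≤s ()))) _
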